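{- Let $G=(K\cup S,E)$ be a split graph. For any $K'\subseteq K$, there is a subset $S'\subseteq S$ of size at most $|K'|-1$ such that $S'$ discriminates $K'$.
   Context: A split graph $G=(K\cup S,E)$ has vertex set partitioned into a clique $K$ and an independent set $S$, the partition being taken with $K$ of maximum size. $N[u]$ denotes the closed neighborhood of $u$. A set $S'\subseteq S$ discriminates a set $K'\subseteq K$ if for any $u,v\in K'$ with $N[u]\neq N[v]$ we have $N[u]\cap S'\neq N[v]\cap S'$. -}

module Defs where

open import Data.Nat using (ℕ; _≤_)
open import Data.Bool using (Bool; true; false; _∨_)
open import Data.Fin using (Fin; _≟_)
open import Data.Fin.Subset using (Subset; _∈_; _⊆_; _∩_; ∁; ∣_∣)
open import Data.Vec using (tabulate)
open import Relation.Nullary using (¬_)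
open import Relation.Nullary.Decidable using (⌊_⌋)
open import Relation.Binary.PropositionalEquality using (_≡_; _≢_)

record SimpleGraph (n : ℕ) : Set where
  field
    adj   : Fin n → Fin n → Bool
    sym   : ∀ u v → adj u v ≡ adj v u
    loopless : ∀ u → adj u u ≡ false
open SimpleGraph public

N[_]_ : {n : ℕ} → Fin n → SimpleGraph n → Subset n
N[ u ] G = tabulate λ v → ⌊ u ≟ v ⌋ ∨ adj G u v

IsClique : {n : ℕ} → SimpleGraph n → Subset n → Set
IsClique G C = ∀ u v → u ∈ C → v ∈ C → u ≢ v → adj G u v ≡ true

IsIndependent : {n : ℕ} → SimpleGraph n → Subset n → Set
IsIndependent G I = ∀ u v → u ∈ I → v ∈ I → adj G u v ≡ false

-- Split partition with K of maximum size (the paper's convention).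
record IsMaxSplitPartition {n : ℕ} (G : SimpleGraph n) (K : Subset n) : Set where
  field
    clique      : IsClique G K
    independent : IsIndependent G (∁ K)
    maximum     : ∀ K₂ → IsClique G K₂ → IsIndependent G (∁ K₂) → ∣ K₂ ∣ ≤ ∣ K ∣

Discriminates : {n : ℕ} → SimpleGraph n → Subset n → Subset n → Set
Discriminates G S' K' =
  ∀ u v → u ∈ K' → v ∈ K' → (N[ u ] G) ≢ (N[ v ] G) →
    ((N[ u ] G) ∩ S') ≢ ((N[ v ] G) ∩ S')

module Submission where

-- The argument is a general fact about a finite family of subsets
-- F u ⊆ {0, …, n-1}, indexed by a list L of members: there is a set S of at
-- most |L| - 1 coordinates whose traces F u ∩ S separate any two members
-- with distinct sets.  It is built member by member.  When a new member x
-- is added, either S still separates x from every earlier member, or some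
-- earlier y has the same trace as x but a different set; then a single
-- coordinate w where F y and F x differ is added to S.  Traces that already
-- differed keep differing, and every earlier member with x's trace has the
-- same set as y, so w separates it from x.  Each added coordinate witnesses
-- a difference between two members, so S lies in any set D containing all
-- such coordinates.
--
-- For the theorem, F u = N[u] and L lists K'.  A clique lies in the closed
-- neighbourhood of each of its vertices, so two neighbourhoods of clique
-- vertices can only differ outside K, and we may take D = ∁ K.

open import Defs hiding (sym)
open import Data.Bool using (true; _∨_; _∧_)
open import Data.Bool.Properties using (∧-identityʳ) renaming (_≟_ to _≟ᵇ_)
open import Data.Empty using (⊥-elim)
open import Data.Fin using (Fin; zero; suc; _≟_)
open import Data.Fin.Properties using (¬∀⟶∃¬)
open import Data.Fin.Subset
  using (Subset; _∈_; _⊆_; _∩_; _∪_; ∁; ⁅_⁆; ∣_∣; ⊥; inside; outside)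
open import Data.Fin.Subset.Properties
  using (∩-assoc; ∩-comm; ∩-abs-∪; x∈⁅x⁆; x∈⁅y⁆⇒x≡y; q⊆p∪q; x∈p∪q⁻; x∉p⇒x∈∁p; ∉⊥; ∣⊥∣≡0; ∣⁅x⁆∣≡1)
open import Data.List using (List; []; _∷_; length; map)
open import Data.List.Properties using (length-map)
open import Data.List.Membership.Propositional using (find; lose) renaming (_∈_ to _∈ₗ_)
open import Data.List.Membership.Propositional.Properties using (∈-map⁺; ∈-map⁻)
open import Data.List.Relation.Unary.Any using (Any; here; there; any?)
open import Data.Nat using (ℕ; _≤_; _∸_; _+_; suc; s≤s)
open import Data.Nat.Properties using (≤-refl; ≤-trans; ≤-reflexive; +-mono-≤; +-suc; +-comm; n≤1+n; m∸n≤m)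
open import Data.Product using (Σ; ∃; _×_; _,_)
open import Data.Sum using (inj₁; inj₂)
open import Data.Vec using ([]; _∷_; here; there; lookup; tabulate)
open import Data.Vec.Properties using (≡-dec; tabulate∘lookup; tabulate-cong; lookup∘tabulate; lookup-zipWith; []=⇒lookup; lookup⇒[]=)
open import Function using (_∘′_)
open import Relation.Nullary using (¬_; Dec; yes; no)
open import Relation.Nullary.Decidable using (⌊_⌋; _×-dec_; ¬?; decidable-stable)
open import Relation.Binary.PropositionalEquality

private
  variable
    n : ℕ

_≟ₛ_ : (p q : Subset n) → Dec (p ≡ q)
_≟ₛ_ = ≡-dec _≟ᵇ_

subset-ext : (p q : Subset n) → (∀ w → lookup p w ≡ lookup q w) → p ≡ q
subset-ext p q same = begin
  p                  ≡⟨ tabulate∘lookup p ⟨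
  tabulate (lookup p) ≡⟨ tabulate-cong same ⟩
  tabulate (lookup q) ≡⟨ tabulate∘lookup q ⟩
  q                  ∎
  where open ≡-Reasoning

difference-witness : {p q : Subset n} → p ≢ q → ∃ λ w → lookup p w ≢ lookup q w
difference-witness {n} {p} {q} p≢q =
  ¬∀⟶∃¬ n (λ w → lookup p w ≡ lookup q w) (λ w → lookup p w ≟ᵇ lookup q w)
    (λ same → p≢q (subset-ext p q same))

lookup-∩-member : (p : Subset n) {S : Subset n} {w : Fin n} →
                  w ∈ S → lookup (p ∩ S) w ≡ lookup p w
lookup-∩-member p {S} {w} w∈S = begin
  lookup (p ∩ S) w             ≡⟨ lookup-zipWith _∧_ w p S ⟩
  lookup p w ∧ lookup S w      ≡⟨ cong (lookup p w ∧_) ([]=⇒lookup w∈S) ⟩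
  lookup p w ∧ true            ≡⟨ ∧-identityʳ (lookup p w) ⟩
  lookup p w                   ∎
  where open ≡-Reasoning

∣p∪q∣≤∣p∣+∣q∣ : (p q : Subset n) → ∣ p ∪ q ∣ ≤ ∣ p ∣ + ∣ q ∣
∣p∪q∣≤∣p∣+∣q∣ [] [] = ≤-refl
∣p∪q∣≤∣p∣+∣q∣ (inside ∷ p) (inside ∷ q) =
  s≤s (≤-trans (∣p∪q∣≤∣p∣+∣q∣ p q) (+-mono-≤ (≤-refl {∣ p ∣}) (n≤1+n ∣ q ∣)))
∣p∪q∣≤∣p∣+∣q∣ (inside ∷ p) (outside ∷ q) = s≤s (∣p∪q∣≤∣p∣+∣q∣ p q)
∣p∪q∣≤∣p∣+∣q∣ (outside ∷ p) (inside ∷ q) =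
  ≤-trans (s≤s (∣p∪q∣≤∣p∣+∣q∣ p q)) (≤-reflexive (sym (+-suc ∣ p ∣ ∣ q ∣)))
∣p∪q∣≤∣p∣+∣q∣ (outside ∷ p) (outside ∷ q) = ∣p∪q∣≤∣p∣+∣q∣ p q

∣p∪⁅x⁆∣≤1+∣p∣ : (p : Subset n) (x : Fin n) → ∣ p ∪ ⁅ x ⁆ ∣ ≤ suc ∣ p ∣
∣p∪⁅x⁆∣≤1+∣p∣ p x = ≤-trans (∣p∪q∣≤∣p∣+∣q∣ p ⁅ x ⁆)
  (≤-reflexive (trans (cong (∣ p ∣ +_) (∣⁅x⁆∣≡1 x)) (+-comm ∣ p ∣ 1)))

elements : Subset n → List (Fin n)
elements [] = []
elements (inside ∷ p) = zero ∷ map suc (elements p)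
elements (outside ∷ p) = map suc (elements p)

length-elements : (p : Subset n) → length (elements p) ≡ ∣ p ∣
length-elements [] = refl
length-elements (inside ∷ p) = cong suc (trans (length-map suc (elements p)) (length-elements p))
length-elements (outside ∷ p) = trans (length-map suc (elements p)) (length-elements p)

∈-elements⁺ : {p : Subset n} {x : Fin n} → x ∈ p → x ∈ₗ elements p
∈-elements⁺ {p = inside ∷ p} here = here refl
∈-elements⁺ {p = inside ∷ p} (there x∈p) = there (∈-map⁺ suc (∈-elements⁺ x∈p))
∈-elements⁺ {p = outside ∷ p} (there x∈p) = ∈-map⁺ suc (∈-elements⁺ x∈p)

∈-elements⁻ : {p : Subset n} {x : Fin n} → x ∈ₗ elements p → x ∈ p
∈-elements⁻ {p = inside ∷ p} (here refl) = here
∈-elements⁻ {p = inside ∷ p} (there x∈) with ∈-map⁻ suc x∈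
... | _ , y∈ , refl = there (∈-elements⁻ y∈)
∈-elements⁻ {p = outside ∷ p} x∈ with ∈-map⁻ suc x∈
... | _ , y∈ , refl = there (∈-elements⁻ y∈)

module Separation {a} {A : Set a} (F : A → Subset n) where

  trace : A → Subset n → Subset n
  trace u S = F u ∩ S

  Separates : Subset n → List A → Set a
  Separates S L = ∀ {u v} → u ∈ₗ L → v ∈ₗ L → F u ≢ F v → trace u S ≢ trace v S

  DifferencesIn : Subset n → List A → Set a
  DifferencesIn D L =
    ∀ {u v} → u ∈ₗ L → v ∈ₗ L → ∀ w → lookup (F u) w ≢ lookup (F v) w → w ∈ D

  trace-restrict : ∀ u S T → trace u (S ∪ T) ∩ S ≡ trace u S
  trace-restrict u S T = begin
    (F u ∩ (S ∪ T)) ∩ S  ≡⟨ ∩-assoc (F u) (S ∪ T) S ⟩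
    F u ∩ ((S ∪ T) ∩ S)  ≡⟨ cong (F u ∩_) (∩-comm (S ∪ T) S) ⟩
    F u ∩ (S ∩ (S ∪ T))  ≡⟨ cong (F u ∩_) (∩-abs-∪ S T) ⟩
    F u ∩ S              ∎
    where open ≡-Reasoning

  trace-grow : ∀ {u v} S T → trace u S ≢ trace v S → trace u (S ∪ T) ≢ trace v (S ∪ T)
  trace-grow {u} {v} S T differ same =
    differ (trans (sym (trace-restrict u S T))
             (trans (cong (_∩ S) same) (trace-restrict v S T)))

  separates-grow : ∀ {S L} T → Separates S L → Separates (S ∪ T) L
  separates-grow {S} T sep u∈ v∈ F≢ = trace-grow S T (sep u∈ v∈ F≢)

  trace-at : ∀ {u v} S w → lookup (F u) w ≢ lookup (F v) w →
             trace u (S ∪ ⁅ w ⁆) ≢ trace v (S ∪ ⁅ w ⁆)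
  trace-at {u} {v} S w differ same = differ (begin
    lookup (F u) w                    ≡⟨ lookup-∩-member (F u) w∈ ⟨
    lookup (trace u (S ∪ ⁅ w ⁆)) w    ≡⟨ cong (λ t → lookup t w) same ⟩
    lookup (trace v (S ∪ ⁅ w ⁆)) w    ≡⟨ lookup-∩-member (F v) w∈ ⟩
    lookup (F v) w                    ∎)
    where
    open ≡-Reasoning
    w∈ : w ∈ S ∪ ⁅ w ⁆
    w∈ = q⊆p∪q S ⁅ w ⁆ (x∈⁅x⁆ w)

  same-trace⇒same-set : ∀ {S L u v} → Separates S L → u ∈ₗ L → v ∈ₗ L →
                        trace u S ≡ trace v S → F u ≡ F v
  same-trace⇒same-set {u = u} {v} sep u∈ v∈ same =
    decidable-stable (F u ≟ₛ F v) (λ F≢ → sep u∈ v∈ F≢ same)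

  separates-cons : ∀ {S L x} → Separates S L →
                   (∀ {z} → z ∈ₗ L → F x ≢ F z → trace x S ≢ trace z S) →
                   Separates S (x ∷ L)
  separates-cons sep new (here refl) (here refl) F≢ = ⊥-elim (F≢ refl)
  separates-cons sep new (here refl) (there v∈) F≢ = new v∈ F≢
  separates-cons sep new (there u∈) (here refl) F≢ same = new u∈ (F≢ ∘′ sym) (sym same)
  separates-cons sep new (there u∈) (there v∈) F≢ = sep u∈ v∈ F≢

  Conflict : Subset n → A → A → Set
  Conflict S x y = trace y S ≡ trace x S × F y ≢ F x

  conflict? : ∀ S x y → Dec (Conflict S x y)
  conflict? S x y = (trace y S ≟ₛ trace x S) ×-dec ¬? (F y ≟ₛ F x)

  no-conflict : ∀ {S L x} → Separates S L → ¬ Any (Conflict S x) L → Separates S (x ∷ L)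
  no-conflict sep none = separates-cons sep
    λ z∈ F≢ same → none (lose z∈ (sym same , λ F≡ → F≢ (sym F≡)))

  -- A conflict with y is resolved by a coordinate w where F y and F x differ:
  -- every earlier member with the trace of x has the set of y.
  resolve-conflict : ∀ {S L x y} w → Separates S L → y ∈ₗ L →
                     trace y S ≡ trace x S → lookup (F y) w ≢ lookup (F x) w →
                     Separates (S ∪ ⁅ w ⁆) (x ∷ L)
  resolve-conflict {S} {L} {x} {y} w sep y∈ y~x w-differs =
    separates-cons (separates-grow ⁅ w ⁆ sep) new
    where
    new : ∀ {z} → z ∈ₗ L → F x ≢ F z → trace x (S ∪ ⁅ w ⁆) ≢ trace z (S ∪ ⁅ w ⁆)
    new {z} z∈ F≢ with trace x S ≟ₛ trace z S
    ... | no x≁z = trace-grow S ⁅ w ⁆ x≁z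
    ... | yes x~z = trace-at S w λ eq →
      w-differs (sym (trans eq (cong (λ p → lookup p w) Fz≡Fy)))
      where
      Fz≡Fy : F z ≡ F y
      Fz≡Fy = same-trace⇒same-set sep z∈ y∈ (sym (trans y~x x~z))

  bound-step : ∀ {y : A} {L} {m : ℕ} → y ∈ₗ L → m ≤ length L ∸ 1 → suc m ≤ length L
  bound-step {L = _ ∷ _} _ m≤ = s≤s m≤

  separating-set : ∀ D L → DifferencesIn D L →
    Σ (Subset n) λ S → S ⊆ D × ∣ S ∣ ≤ length L ∸ 1 × Separates S L
  separating-set D [] _ = ⊥ , (λ w∈⊥ → ⊥-elim (∉⊥ w∈⊥)) , ≤-reflexive (∣⊥∣≡0 n) , λ ()
  separating-set D (x ∷ L) diffs
    with separating-set D L (λ u∈ v∈ → diffs (there u∈) (there v∈))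
  ... | S , S⊆D , size , sep with any? (conflict? S x) L
  ... | no none = S , S⊆D , ≤-trans size (m∸n≤m (length L) 1) , no-conflict sep none
  ... | yes some with find some
  ... | y , y∈ , y~x , Fy≢Fx with difference-witness Fy≢Fx
  ... | w , w-differs =
    S ∪ ⁅ w ⁆ , S∪w⊆D , ≤-trans (∣p∪⁅x⁆∣≤1+∣p∣ S w) (bound-step y∈ size) ,
    resolve-conflict w sep y∈ y~x w-differs
    where
    S∪w⊆D : S ∪ ⁅ w ⁆ ⊆ D
    S∪w⊆D v∈ with x∈p∪q⁻ S ⁅ w ⁆ v∈
    ... | inj₁ v∈S = S⊆D v∈S
    ... | inj₂ v∈w rewrite x∈⁅y⁆⇒x≡y w v∈w = diffs (there y∈) (here refl) w w-differs

clique⊆neighbourhood : (G : SimpleGraph n) {K : Subset n} → IsClique G K →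
                       ∀ {u} → u ∈ K → K ⊆ N[ u ] G
clique⊆neighbourhood G cl {u} u∈K {w} w∈K =
  lookup⇒[]= w (N[ u ] G) (trans (lookup∘tabulate (λ v → ⌊ u ≟ v ⌋ ∨ adj G u v) w) adjacent)
  where
  adjacent : ⌊ u ≟ w ⌋ ∨ adj G u w ≡ true
  adjacent with u ≟ w
  ... | yes _ = refl
  ... | no u≢w = cl u w u∈K w∈K u≢w

neighbourhood-differences : (G : SimpleGraph n) {K K' : Subset n} → IsClique G K → K' ⊆ K →
  Separation.DifferencesIn (λ u → N[ u ] G) (∁ K) (elements K')
neighbourhood-differences G {K} {K'} cl K'⊆K u∈ v∈ w differ = x∉p⇒x∈∁p λ w∈K →
  differ (trans (in-neighbourhood u∈ w∈K) (sym (in-neighbourhood v∈ w∈K)))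
  where
  in-neighbourhood : ∀ {x} → x ∈ₗ elements K' → w ∈ K → lookup (N[ x ] G) w ≡ true
  in-neighbourhood x∈ w∈K = []=⇒lookup (clique⊆neighbourhood G cl (K'⊆K (∈-elements⁻ x∈)) w∈K)

-- The theorem: separate the closed neighbourhoods of the listed vertices of K'
-- inside ∁ K.
mainTheorem19 : (n : ℕ) (G : SimpleGraph n) (K : Subset n) →
    IsMaxSplitPartition G K →
    (K' : Subset n) → K' ⊆ K →
    Σ (Subset n) λ S' → S' ⊆ ∁ K × ∣ S' ∣ ≤ ∣ K' ∣ ∸ 1 × Discriminates G S' K'
mainTheorem19 n G K split K' K'⊆K
  with Separation.separating-set (λ u → N[ u ] G) (∁ K) (elements K')
         (neighbourhood-differences G (IsMaxSplitPartition.clique split) K'⊆K)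
... | S , S⊆∁K , size , separates =
  S , S⊆∁K , subst (λ m → ∣ S ∣ ≤ m ∸ 1) (length-elements K') size ,
  λ u v u∈K' v∈K' → separates (∈-elements⁺ u∈K') (∈-elements⁺ v∈K')
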